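{- Let $M$ be a matroid on a finite set $E$ with a fixed linear order. For any linear extension $\prec$ of the external/internal order $\le_{ext/int}$ restricted to the nbc sets of $M$, listing the facets $G(I)$ of the augmented nbc complex $\Delta^{\mathrm{nbc}}_M$ in the order $\prec$ is a shelling order.
   Context: Activities: for $S\subseteq E$, $e\in E\setminus S$ is externally active w.r.t. $S$ if there is a circuit $\gamma\subseteq S\cup\{e\}$ of $M$ with $e=\max\gamma$; set $\operatorname{EA}(S)$. An element $i\in S$ is internally active w.r.t. $S$ if it is externally active w.r.t. $E\setminus S$ in the dual matroid $M^\perp$ (same order); set $\operatorname{IA}(S)$. Every independent set $I$ is uniquely $B\setminus Y$ with $B$ a basis ($B_I$, the related basis) and $Y\subseteq\operatorname{IA}(B)$; internally related = same related basis. nbc sets: a broken circuit is a circuit with its maximum element removed; an nbc set is a subset containing no broken circuit; equivalently an independent set $I$ with $\operatorname{EA}(I)=\emptyset$. They form the complex $\mathrm{NBC}(M)$. Order: $I\le_{ext/int}J$ iff either $I,J$ not internally related and $(I\setminus\operatorname{IA}(I))\cup\operatorname{EA}(I)\subseteq(J\setminus\operatorname{IA}(J))\cup\operatorname{EA}(J)$, or internally related and $I\subseteq J$. Augmented nbc complex $\Delta^{\mathrm{nbc}}_M$: vertex set $\{y_e,z_e:e\in E\}$, facets $G(I)=y_{B_I\setminus I}z_I$ for every nbc set $I$, where $y_S=\{y_e:e\in S\}$, $z_S=\{z_e:e\in S\}$. Shelling order: ordering $F_1,\dots,F_s$ of facets of a pure complex such that for all $i<k$ there exist $j<k$ and a vertex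 $e\in F_k$ with $F_i\cap F_k\subseteq F_j\cap F_k=F_k\setminus\{e\}$. -}

module Defs where

open import Data.Nat using (ℕ; _<_)
open import Data.Fin using (Fin) renaming (_≤_ to _≤ᶠ_; _<_ to _<ᶠ_)
open import Data.Fin.Subset
  using (Subset; _∈_; _∉_; _⊆_; _⊂_; _∪_; _∩_; ∁; ⁅_⁆; _-_; ∣_∣; ⊥)
open import Data.Product using (Σ; _×_; _,_; ∃)
open import Data.Sum using (_⊎_)
open import Data.List using (List; length; lookup)
open import Data.List.Relation.Unary.All using (All)
open import Data.List.Relation.Unary.Unique.Propositional using (Unique)
import Data.List.Membership.Propositional as ListMem
open import Relation.Binary.PropositionalEquality using (_≡_)
open import Relation.Nullary using (¬_)

-- Ground set E = Fin n, linearly ordered by the natural order of Fin n.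

record Matroid (n : ℕ) : Set₁ where
  field
    Indep    : Subset n → Set
    indep-⊥  : Indep ⊥
    indep-⊆  : ∀ {I J} → J ⊆ I → Indep I → Indep J
    exchange : ∀ {I J} → Indep I → Indep J → ∣ I ∣ < ∣ J ∣ →
               ∃ λ e → e ∈ J × e ∉ I × Indep (I ∪ ⁅ e ⁆)

module _ {n : ℕ} where

  -- Notions relative to an arbitrary independence predicate (so that they
  -- apply both to M and to its dual M^⊥).

  Circuit : (Subset n → Set) → Subset n → Set
  Circuit Ind γ = ¬ Ind γ × (∀ T → T ⊂ γ → Ind T)

  IsMax : Fin n → Subset n → Set
  IsMax e γ = e ∈ γ × (∀ x → x ∈ γ → x ≤ᶠ e)

  ExtActive : (Subset n → Set) → Subset n → Fin n → Set
  ExtActive Ind S e =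
    e ∉ S × Σ (Subset n) λ γ → Circuit Ind γ × γ ⊆ (S ∪ ⁅ e ⁆) × IsMax e γ

  IsBasis : (Subset n → Set) → Subset n → Set
  IsBasis Ind B = Ind B × (∀ J → Ind J → B ⊆ J → J ≡ B)

  DualIndep : Matroid n → Subset n → Set
  DualIndep M I = Σ (Subset n) λ B → IsBasis (Matroid.Indep M) B × (I ∩ B) ≡ ⊥

  EA : Matroid n → Subset n → Fin n → Set
  EA M = ExtActive (Matroid.Indep M)

  IA : Matroid n → Subset n → Fin n → Set
  IA M S i = ExtActive (DualIndep M) (∁ S) i

  RelBasis : Matroid n → Subset n → Subset n → Set
  RelBasis M I B = IsBasis (Matroid.Indep M) B × I ⊆ B ×
                   (∀ e → e ∈ B → e ∉ I → IA M B e)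

  IntRelated : Matroid n → Subset n → Subset n → Set
  IntRelated M I J = Σ (Subset n) λ B → RelBasis M I B × RelBasis M J B

  BrokenCircuit : Matroid n → Subset n → Set
  BrokenCircuit M β = Σ (Subset n) λ γ → Σ (Fin n) λ e →
    Circuit (Matroid.Indep M) γ × IsMax e γ × β ≡ γ - e

  NBC : Matroid n → Subset n → Set
  NBC M I = ∀ β → BrokenCircuit M β → ¬ (β ⊆ I)

  InKey : Matroid n → Subset n → Fin n → Set
  InKey M I x = (x ∈ I × ¬ IA M I x) ⊎ EA M I x

  _≤ext/int[_]_ : Subset n → Matroid n → Subset n → Set
  I ≤ext/int[ M ] J =
    (¬ IntRelated M I J × (∀ x → InKey M I x → InKey M J x))
    ⊎ (IntRelated M I J × I ⊆ J)

  IsLinExtNBC : Matroid n → List (Subset n) → Set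
  IsLinExtNBC M L =
    All (NBC M) L × Unique L × (∀ I → NBC M I → I ListMem.∈ L) ×
    (∀ (i k : Fin (length L)) →
       lookup L i ≤ext/int[ M ] lookup L k → i ≤ᶠ k)

  -- Faces of the augmented nbc complex: vertices y_e (inj₁) and z_e (inj₂);
  -- a face is given by the pair (Y , Z) of index sets.
  Face : Set
  Face = Subset n × Subset n

  Vertex : Set
  Vertex = Fin n ⊎ Fin n

  _∈V_ : Vertex → Face → Set
  Data.Sum.inj₁ e ∈V (Y , Z) = e ∈ Y
  Data.Sum.inj₂ e ∈V (Y , Z) = e ∈ Z

  _∩F_ : Face → Face → Face
  (Y , Z) ∩F (Y′ , Z′) = (Y ∩ Y′) , (Z ∩ Z′)

  _⊆F_ : Face → Face → Set
  (Y , Z) ⊆F (Y′ , Z′) = Y ⊆ Y′ × Z ⊆ Z′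

  _minusV_ : Face → Vertex → Face
  (Y , Z) minusV Data.Sum.inj₁ e = (Y - e) , Z
  (Y , Z) minusV Data.Sum.inj₂ e = Y , (Z - e)

  -- G(I) = y_{B_I \ I} z_I, where B is the related basis of I
  G : Subset n → Subset n → Face
  G I B = (B ∩ ∁ I) , I

  IsShelling : (s : ℕ) → (Fin s → Face) → Set
  IsShelling s F = ∀ (i k : Fin s) → i <ᶠ k →
    Σ (Fin s) λ j → j <ᶠ k × Σ Vertex λ e → e ∈V F k ×
      ((F i ∩F F k) ⊆F (F j ∩F F k)) × ((F j ∩F F k) ≡ (F k minusV e))

-- Let G(I′) precede G(I). If I ⊆ I′ then I ≤ext/int I′, because EA vanishes on the nbc set I
-- and IA is antitone; so there is x ∈ I ∖ I′. The nbc set J = I ∖ x is then ≤ext/int I, hence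
-- precedes it. Its related basis contains B_I ∖ x: exchanging x in B_I for the greatest f that
-- keeps a basis, f and every element of B_I ∖ I remain the maximum of their fundamental
-- cocircuits. Thus G(J) ∩ G(I) is G(I) without z_x, and it contains G(I′) ∩ G(I) as z_x ∉ G(I′).
-- Independence is not assumed decidable; it is ¬¬-decidable on a finite ground set, which
-- suffices because what we derive from it, membership in the related basis of J, is decidable.

module Submission where

open import Defs
open import Data.Bool using (true; false)
open import Data.Empty using (⊥-elim)
open import Data.Fin using (Fin; zero; suc) renaming (_≤_ to _≤ᶠ_; _<_ to _<ᶠ_)
import Data.Fin.Properties as Finₚ
open import Data.Fin.Subset
open import Data.Fin.Subset.Properties
open import Data.List using (List; length; lookup)
open import Data.List.Membership.Propositional using () renaming (_∈_ to _∈ₗ_)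
open import Data.List.Membership.Propositional.Properties using (∈-lookup)
import Data.List.Relation.Unary.All as All
open import Data.List.Relation.Unary.Any using (index)
open import Data.List.Relation.Unary.Any.Properties using (lookup-index)
open import Data.Nat as ℕ using (ℕ; zero; suc; s≤s; z≤n)
import Data.Nat.Properties as ℕₚ
open import Data.Product using (∃; _×_; _,_; proj₁; proj₂)
open import Data.Sum using (_⊎_; inj₁; inj₂)
open import Data.Vec using ([]; _∷_; here; there)
open import Function using (_∘_)
open import Relation.Binary.PropositionalEquality using (_≡_; _≢_; refl; sym; trans; cong; cong₂; subst)
open import Relation.Nullary
open import Relation.Nullary.Decidable using (_×-dec_; _⊎-dec_; _→-dec_)
open import Relation.Unary using (Decidable)

private variable
  n : ℕ
  x y g : Fin n
  p q : Subset n

x∈p─q⇒x∉q : ∀ (p q : Subset n) → x ∈ p ─ q → x ∉ q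
x∈p─q⇒x∉q (true  ∷ p) (false ∷ q) here      ()
x∈p─q⇒x∉q (_     ∷ p) (_     ∷ q) (there m) (there m′) = x∈p─q⇒x∉q p q m m′

y∉p-y : y ∉ p - y
y∉p-y {y = y} {p = p} m = x∈p─q⇒x∉q p ⁅ y ⁆ m (x∈⁅x⁆ y)

x∈p-y⇒x∈p : x ∈ p - y → x ∈ p
x∈p-y⇒x∈p {p = p} {y = y} = p─q⊆p p ⁅ y ⁆

x∈p-y⇒x≢y : x ∈ p - y → x ≢ y
x∈p-y⇒x≢y m refl = y∉p-y m

x∈p∪⁅y⁆⁻ : x ∈ p ∪ ⁅ y ⁆ → x ∈ p ⊎ x ≡ y
x∈p∪⁅y⁆⁻ {p = p} {y = y} m with x∈p∪q⁻ p ⁅ y ⁆ m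
... | inj₁ x∈p = inj₁ x∈p
... | inj₂ x∈y = inj₂ (x∈⁅y⁆⇒x≡y y x∈y)

p⊆p∪⁅y⁆ : p ⊆ p ∪ ⁅ y ⁆
p⊆p∪⁅y⁆ {y = y} = p⊆p∪q ⁅ y ⁆

y∈p∪⁅y⁆ : y ∈ p ∪ ⁅ y ⁆
y∈p∪⁅y⁆ {y = y} {p = p} = q⊆p∪q p ⁅ y ⁆ (x∈⁅x⁆ y)

p-y∪⁅y⁆⊆p : y ∈ p → (p - y) ∪ ⁅ y ⁆ ⊆ p
p-y∪⁅y⁆⊆p y∈p m with x∈p∪⁅y⁆⁻ m
... | inj₁ x∈p-y = x∈p-y⇒x∈p x∈p-y
... | inj₂ refl  = y∈p

p⊆p-y∪⁅y⁆ : p ⊆ (p - y) ∪ ⁅ y ⁆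
p⊆p-y∪⁅y⁆ {y = y} {x = x} x∈p with x Finₚ.≟ y
... | yes refl = y∈p∪⁅y⁆
... | no  x≢y  = p⊆p∪⁅y⁆ (x∈p∧x≢y⇒x∈p-y x∈p x≢y)

p⊆p∪⁅y⁆-y : y ∉ p → p ⊆ (p ∪ ⁅ y ⁆) - y
p⊆p∪⁅y⁆-y y∉p x∈p = x∈p∧x≢y⇒x∈p-y (p⊆p∪⁅y⁆ x∈p) λ { refl → y∉p x∈p }

-‿monoˡ : p ⊆ q → p - y ⊆ q - y
-‿monoˡ p⊆q m = x∈p∧x≢y⇒x∈p-y (p⊆q (x∈p-y⇒x∈p m)) (x∈p-y⇒x≢y m)

∪⁅⁆-monoˡ : p ⊆ q → p ∪ ⁅ g ⁆ ⊆ q ∪ ⁅ g ⁆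
∪⁅⁆-monoˡ p⊆q m with x∈p∪⁅y⁆⁻ m
... | inj₁ x∈p = p⊆p∪⁅y⁆ (p⊆q x∈p)
... | inj₂ refl = y∈p∪⁅y⁆

∪⁅⁆-exchange : p ∪ ⁅ g ⁆ ⊆ ((p - y) ∪ ⁅ g ⁆) ∪ ⁅ y ⁆
∪⁅⁆-exchange m with x∈p∪⁅y⁆⁻ m
... | inj₂ refl = p⊆p∪⁅y⁆ y∈p∪⁅y⁆
... | inj₁ x∈p = ∪⁅⁆-monoˡ p⊆p∪⁅y⁆ (p⊆p-y∪⁅y⁆ x∈p)

∣p∪⁅y⁆∣≤1+∣p∣ : ∀ (p : Subset n) y → ∣ p ∪ ⁅ y ⁆ ∣ ℕ.≤ suc ∣ p ∣
∣p∪⁅y⁆∣≤1+∣p∣ (true  ∷ p) zero    rewrite ∪-identityʳ p = ℕₚ.n≤1+n _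
∣p∪⁅y⁆∣≤1+∣p∣ (false ∷ p) zero    rewrite ∪-identityʳ p = ℕₚ.≤-refl
∣p∪⁅y⁆∣≤1+∣p∣ (true  ∷ p) (suc y) = s≤s (∣p∪⁅y⁆∣≤1+∣p∣ p y)
∣p∪⁅y⁆∣≤1+∣p∣ (false ∷ p) (suc y) = ∣p∪⁅y⁆∣≤1+∣p∣ p y

y∉p⇒∣p∣<∣p∪⁅y⁆∣ : y ∉ p → ∣ p ∣ ℕ.< ∣ p ∪ ⁅ y ⁆ ∣
y∉p⇒∣p∣<∣p∪⁅y⁆∣ {y = y} y∉p = p⊂q⇒∣p∣<∣q∣ (p⊆p∪⁅y⁆ , y , y∈p∪⁅y⁆ , y∉p)

∣p∣≤∣p-y∪⁅g⁆∣ : g ∉ p - y → ∣ p ∣ ℕ.≤ ∣ (p - y) ∪ ⁅ g ⁆ ∣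
∣p∣≤∣p-y∪⁅g⁆∣ {g = g} {p = p} {y = y} g∉ = begin
  ∣ p ∣                 ≤⟨ p⊆q⇒∣p∣≤∣q∣ (p⊆p-y∪⁅y⁆ {p = p} {y = y}) ⟩
  ∣ (p - y) ∪ ⁅ y ⁆ ∣   ≤⟨ ∣p∪⁅y⁆∣≤1+∣p∣ (p - y) y ⟩
  suc ∣ p - y ∣         ≤⟨ y∉p⇒∣p∣<∣p∪⁅y⁆∣ g∉ ⟩
  ∣ (p - y) ∪ ⁅ g ⁆ ∣   ∎
  where open ℕₚ.≤-Reasoning

Greatest : (Fin n → Set) → Fin n → Set
Greatest P y = P y × (∀ z → P z → z ≤ᶠ y)

Least : (Fin n → Set) → Fin n → Set
Least P y = P y × (∀ z → P z → y ≤ᶠ z)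

greatest : {P : Fin n → Set} → Decidable P → ∃ P → ∃ (Greatest P)
greatest {suc n} {P} P? ∃P with Finₚ.any? (P? ∘ suc)
... | yes ∃P∘suc =
  let y , py , max = greatest (P? ∘ suc) ∃P∘suc
  in suc y , py , λ { zero _ → z≤n ; (suc z) pz → s≤s (max z pz) }
... | no ∄P∘suc = zero , P0 ∃P , λ { zero _ → z≤n ; (suc z) pz → ⊥-elim (∄P∘suc (z , pz)) }
  where
  P0 : ∃ P → P zero
  P0 (zero  , p0) = p0
  P0 (suc y , py) = ⊥-elim (∄P∘suc (y , py))

least : {P : Fin n → Set} → Decidable P → ∃ P → ∃ (Least P)
least {suc n} {P} P? ∃P with P? zero
... | yes p0 = zero , p0 , λ _ _ → z≤n
... | no ¬p0 =
  let y , py , min = least (P? ∘ suc) (tail ∃P)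
  in suc y , py , λ { zero p0 → ⊥-elim (¬p0 p0) ; (suc z) pz → s≤s (min z pz) }
  where
  tail : ∃ P → ∃ (P ∘ suc)
  tail (zero  , p0) = ⊥-elim (¬p0 p0)
  tail (suc y , py) = y , py

¬⊆⇒∃∉ : ¬ (p ⊆ q) → ∃ λ x → x ∈ p × x ∉ q
¬⊆⇒∃∉ {p = p} {q = q} p⊈q =
  let x , ¬[x∈p⇒x∈q] = Finₚ.¬∀⟶∃¬ _ _ (λ x → x ∈? p →-dec x ∈? q) (λ ⊆ → p⊈q (⊆ _))
  in x , decidable-stable (x ∈? p) (λ x∉p → ¬[x∈p⇒x∈q] (⊥-elim ∘ x∉p)) , ¬[x∈p⇒x∈q] ∘ λ x∈q _ → x∈q

toSubset : {P : Fin n → Set} → Decidable P → Subset n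
toSubset {zero}  P? = []
toSubset {suc n} P? = does (P? zero) ∷ toSubset (P? ∘ suc)

∈-toSubset⁺ : {P : Fin n → Set} (P? : Decidable P) → P x → x ∈ toSubset P?
∈-toSubset⁺ {x = zero}  P? px with P? zero
... | yes _ = here
... | no ¬px = ⊥-elim (¬px px)
∈-toSubset⁺ {x = suc x} P? px = there (∈-toSubset⁺ (P? ∘ suc) px)

∈-toSubset⁻ : {P : Fin n → Set} (P? : Decidable P) → x ∈ toSubset P? → P x
∈-toSubset⁻ {x = zero}  P? m with P? zero | m
... | yes px | _ = px
∈-toSubset⁻ {x = suc x} P? (there m) = ∈-toSubset⁻ (P? ∘ suc) m

¬¬-decidable : (P : Subset n → Set) → ¬ ¬ Decidable P
¬¬-decidable {zero} P ¬dec = ¬¬-excluded-middle λ P[]? → ¬dec λ { [] → P[]? }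
¬¬-decidable {suc n} P ¬dec =
  ¬¬-decidable (P ∘ (false ∷_)) λ P₀? →
  ¬¬-decidable (P ∘ (true ∷_)) λ P₁? →
  ¬dec λ { (false ∷ S) → P₀? S ; (true ∷ S) → P₁? S }

module MatroidProperties {n : ℕ} (M : Matroid n) where
  open Matroid M

  Basis : Subset n → Set
  Basis = IsBasis Indep

  private variable
    B B₁ B₂ I S : Subset n

  basis-maximal : Basis B → Indep (B ∪ ⁅ g ⁆) → g ∈ B
  basis-maximal {g = g} (_ , maximal) indep = subst (g ∈_) (maximal _ indep p⊆p∪⁅y⁆) y∈p∪⁅y⁆

  ∣indep∣≤∣basis∣ : Indep S → Basis B → ∣ S ∣ ℕ.≤ ∣ B ∣
  ∣indep∣≤∣basis∣ {S} {B} indS basisB with ∣ S ∣ ℕ.≤? ∣ B ∣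
  ... | yes ≤ = ≤
  ... | no  ≰ =
    let g , _ , g∉B , indep = exchange (proj₁ basisB) indS (ℕₚ.≰⇒> ≰)
    in ⊥-elim (g∉B (basis-maximal basisB indep))

  large-indep⇒basis : Indep S → Basis B → ∣ B ∣ ℕ.≤ ∣ S ∣ → Basis S
  large-indep⇒basis {S} {B} indS basisB ∣B∣≤∣S∣ = indS , maximal
    where
    maximal : ∀ J → Indep J → S ⊆ J → J ≡ S
    maximal J indJ S⊆J = ⊆-antisym J⊆S S⊆J
      where
      J⊆S : J ⊆ S
      J⊆S {z} z∈J = decidable-stable (z ∈? S) λ z∉S →
        let ∣S∣<∣J∣ = p⊂q⇒∣p∣<∣q∣ (S⊆J , z , z∈J , z∉S)
            g , _ , g∉B , indep = exchange (proj₁ basisB) indJ (ℕₚ.≤-<-trans ∣B∣≤∣S∣ ∣S∣<∣J∣)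
        in g∉B (basis-maximal basisB indep)

  Replaces : Subset n → Fin n → Fin n → Set
  Replaces B y g = g ∉ B - y × Indep ((B - y) ∪ ⁅ g ⁆)

  replaces-self : Basis B → y ∈ B → Replaces B y y
  replaces-self basisB y∈B = y∉p-y , indep-⊆ (p-y∪⁅y⁆⊆p y∈B) (proj₁ basisB)

  replace-basis : Basis B → Replaces B y g → Basis ((B - y) ∪ ⁅ g ⁆)
  replace-basis basisB (g∉B-y , indep) = large-indep⇒basis indep basisB (∣p∣≤∣p-y∪⁅g⁆∣ g∉B-y)

  -- y is the maximum of its fundamental cocircuit with respect to B.
  ReplacementMaximal : Subset n → Fin n → Set
  ReplacementMaximal B y = ∀ g → Replaces B y g → g ≤ᶠ y

  IA⇒ReplacementMaximal : Basis B → IA M B y → ReplacementMaximal B y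
  IA⇒ReplacementMaximal {B} {y} basisB (_ , D , (D-dependent , _) , D⊆∁B∪y , _ , y-max) g replaces =
    decidable-stable (g Finₚ.≤? y) λ g≰y →
      D-dependent (_ , replace-basis basisB replaces , Empty-unique (disjoint g≰y))
    where
    disjoint : ¬ g ≤ᶠ y → Empty (D ∩ ((B - y) ∪ ⁅ g ⁆))
    disjoint g≰y (w , w∈) with x∈p∩q⁻ D _ w∈
    ... | w∈D , w∈B′ with x∈p∪⁅y⁆⁻ w∈B′
    ... | inj₂ refl = g≰y (y-max g w∈D)
    ... | inj₁ w∈B-y with x∈p∪⁅y⁆⁻ (D⊆∁B∪y w∈D)
    ...   | inj₁ w∈∁B = x∈∁p⇒x∉p w∈∁B (x∈p-y⇒x∈p w∈B-y)
    ...   | inj₂ w≡y  = x∈p-y⇒x≢y w∈B-y w≡y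

  module _ (Indep? : Decidable Indep) where

    Replaces? : ∀ B y → Decidable (Replaces B y)
    Replaces? B y g = ¬? (g ∈? B - y) ×-dec Indep? _

    fundamental-cocircuit : Subset n → Fin n → Subset n
    fundamental-cocircuit B y = toSubset (Replaces? B y)

    fundamental-cocircuit-is-cocircuit : Basis B → y ∈ B →
      Circuit (DualIndep M) (fundamental-cocircuit B y)
    fundamental-cocircuit-is-cocircuit {B} {y} basisB y∈B = dependent , proper-subsets-independent
      where
      D : Subset n
      D = fundamental-cocircuit B y

      dependent : ¬ DualIndep M D
      dependent (B₂ , basisB₂ , D∩B₂≡⊥) =
        let ∣B-y∣<∣B₂∣ = ℕₚ.<-≤-trans (x∈p⇒∣p-x∣<∣p∣ y∈B) (∣indep∣≤∣basis∣ (proj₁ basisB) basisB₂)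
            h , h∈B₂ , h∉B-y , indep =
              exchange (indep-⊆ x∈p-y⇒x∈p (proj₁ basisB)) (proj₁ basisB₂) ∣B-y∣<∣B₂∣
        in ∉⊥ (subst (h ∈_) D∩B₂≡⊥ (x∈p∩q⁺ (∈-toSubset⁺ (Replaces? B y) (h∉B-y , indep) , h∈B₂)))

      proper-subsets-independent : ∀ T → T ⊂ D → DualIndep M T
      proper-subsets-independent T (T⊆D , g , g∈D , g∉T) =
        _ , replace-basis basisB replaces , Empty-unique disjoint
        where
        replaces : Replaces B y g
        replaces = ∈-toSubset⁻ (Replaces? B y) g∈D
        disjoint : Empty (T ∩ ((B - y) ∪ ⁅ g ⁆))
        disjoint (w , w∈) with x∈p∩q⁻ T _ w∈
        ... | w∈T , w∈B′ with x∈p∪⁅y⁆⁻ w∈B′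
        ... | inj₁ w∈B-y = proj₁ (∈-toSubset⁻ (Replaces? B y) (T⊆D w∈T)) w∈B-y
        ... | inj₂ refl  = g∉T w∈T

    ReplacementMaximal⇒IA : Basis B → y ∈ B → ReplacementMaximal B y → IA M B y
    ReplacementMaximal⇒IA {B} {y} basisB y∈B y-max =
      x∈p⇒x∉∁p y∈B , fundamental-cocircuit B y , fundamental-cocircuit-is-cocircuit basisB y∈B ,
      D⊆∁B∪y , ∈-toSubset⁺ (Replaces? B y) (replaces-self basisB y∈B) ,
      (λ g g∈D → y-max g (∈-toSubset⁻ (Replaces? B y) g∈D))
      where
      D⊆∁B∪y : fundamental-cocircuit B y ⊆ ∁ B ∪ ⁅ y ⁆
      D⊆∁B∪y {g} g∈D with g Finₚ.≟ y
      ... | yes refl = y∈p∪⁅y⁆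
      ... | no  g≢y  = p⊆p∪⁅y⁆ (x∉p⇒x∈∁p λ g∈B →
                         proj₁ (∈-toSubset⁻ (Replaces? B y) g∈D) (x∈p∧x≢y⇒x∈p-y g∈B g≢y))

  -- The fundamental cocircuit of y lies below y off B₁, so it would be disjoint from B₂.
  RelBasis-differs-below : RelBasis M I B₁ → Basis B₂ → I ⊆ B₂ → y ∈ B₁ → y ∉ B₂ →
    ¬ (∀ z → z <ᶠ y → z ∈ B₂ → z ∈ B₁)
  RelBasis-differs-below {I} {B₁} {B₂} {y} (_ , _ , active) basisB₂ I⊆B₂ y∈B₁ y∉B₂ agree-below
    with active y y∈B₁ (y∉B₂ ∘ I⊆B₂)
  ... | _ , D , (D-dependent , _) , D⊆∁B₁∪y , _ , y-max = D-dependent (B₂ , basisB₂ , Empty-unique disjoint)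
    where
    disjoint : Empty (D ∩ B₂)
    disjoint (w , w∈) with x∈p∩q⁻ D B₂ w∈
    ... | w∈D , w∈B₂ with w Finₚ.≟ y
    ... | yes refl = y∉B₂ w∈B₂
    ... | no  w≢y with x∈p∪⁅y⁆⁻ (D⊆∁B₁∪y w∈D)
    ...   | inj₁ w∈∁B₁ = x∈∁p⇒x∉p w∈∁B₁ (agree-below w (Finₚ.≤∧≢⇒< (y-max w w∈D) w≢y) w∈B₂)
    ...   | inj₂ w≡y   = w≢y w≡y

  RelBasis-⊆ : RelBasis M I B₁ → RelBasis M I B₂ → B₁ ⊆ B₂
  RelBasis-⊆ {I} {B₁} {B₂} rel₁ rel₂ {y} y∈B₁ = decidable-stable (y ∈? B₂) λ y∉B₂ →
    let z , least-z = least △? (y , inj₁ (y∈B₁ , y∉B₂)) in no-least-difference z least-z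
    where
    △ : Fin n → Set
    △ w = (w ∈ B₁ × w ∉ B₂) ⊎ (w ∈ B₂ × w ∉ B₁)
    △? : Decidable △
    △? w = (w ∈? B₁ ×-dec ¬? (w ∈? B₂)) ⊎-dec (w ∈? B₂ ×-dec ¬? (w ∈? B₁))
    agree-below : ∀ {C C′} z → (∀ w → △ w → z ≤ᶠ w) → (∀ {w} → w ∈ C → w ∉ C′ → △ w) →
                  ∀ w → w <ᶠ z → w ∈ C → w ∈ C′
    agree-below {C′ = C′} z z-least △-intro w w<z w∈C =
      decidable-stable (w ∈? C′) λ w∉C′ → ℕₚ.<⇒≱ w<z (z-least w (△-intro w∈C w∉C′))
    no-least-difference : ∀ z → ¬ Least △ z
    no-least-difference z (inj₁ (z∈B₁ , z∉B₂) , z-least) =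
      RelBasis-differs-below rel₁ (proj₁ rel₂) (proj₁ (proj₂ rel₂)) z∈B₁ z∉B₂
        (agree-below z z-least λ w∈B₂ w∉B₁ → inj₂ (w∈B₂ , w∉B₁))
    no-least-difference z (inj₂ (z∈B₂ , z∉B₁) , z-least) =
      RelBasis-differs-below rel₂ (proj₁ rel₁) (proj₁ (proj₂ rel₁)) z∈B₂ z∉B₁
        (agree-below z z-least λ w∈B₁ w∉B₂ → inj₁ (w∈B₁ , w∉B₂))

  RelBasis-unique : RelBasis M I B₁ → RelBasis M I B₂ → B₁ ≡ B₂
  RelBasis-unique rel₁ rel₂ = ⊆-antisym (RelBasis-⊆ rel₁ rel₂) (RelBasis-⊆ rel₂ rel₁)

  module ReplaceByGreatest {B x f} (basisB : Basis B) (x∈B : x ∈ B)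
                           (f-greatest : Greatest (Replaces B x) f) where

    B′ : Subset n
    B′ = (B - x) ∪ ⁅ f ⁆

    private
      f-replaces : Replaces B x f
      f-replaces = proj₁ f-greatest

      f-max : ∀ g → Replaces B x g → g ≤ᶠ f
      f-max = proj₂ f-greatest

      B-x⊆B′-f : B - x ⊆ B′ - f
      B-x⊆B′-f = p⊆p∪⁅y⁆-y (proj₁ f-replaces)

      <-<-≤-contradiction : ∀ {a b c : Fin n} → a <ᶠ b → b <ᶠ c → ¬ c ≤ᶠ a
      <-<-≤-contradiction a<b b<c = ℕₚ.<⇒≱ (ℕₚ.<-trans a<b b<c)

    B′-basis : Basis B′
    B′-basis = replace-basis basisB f-replaces

    f-ReplacementMaximal : ReplacementMaximal B′ f
    f-ReplacementMaximal g (g∉B′-f , indep) =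
      f-max g (g∉B′-f ∘ B-x⊆B′-f , indep-⊆ (∪⁅⁆-monoˡ B-x⊆B′-f) indep)

    no-replacement-across : y ∈ B - x → ReplacementMaximal B y → f <ᶠ y → y <ᶠ g →
                            ¬ Replaces B′ y g
    no-replacement-across {y} {g} y∈B-x y-max f<y y<g (g∉B′-y , C-indep) =
      let h , h∈B , h∉T , indep = exchange (indep-⊆ T⊆C C-indep) (proj₁ basisB) ∣T∣<∣B∣
      in no-augmentation h h∈B h∉T indep
      where
      T : Subset n
      T = ((B - x) - y) ∪ ⁅ g ⁆

      T⊆C : T ⊆ (B′ - y) ∪ ⁅ g ⁆
      T⊆C = ∪⁅⁆-monoˡ (-‿monoˡ p⊆p∪⁅y⁆)

      ∣T∣<∣B∣ : ∣ T ∣ ℕ.< ∣ B ∣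
      ∣T∣<∣B∣ = begin-strict
        ∣ T ∣                 ≤⟨ ∣p∪⁅y⁆∣≤1+∣p∣ ((B - x) - y) g ⟩
        suc ∣ (B - x) - y ∣   ≤⟨ x∈p⇒∣p-x∣<∣p∣ y∈B-x ⟩
        ∣ B - x ∣             <⟨ x∈p⇒∣p-x∣<∣p∣ x∈B ⟩
        ∣ B ∣                 ∎
        where open ℕₚ.≤-Reasoning

      g∉B : g ∉ B
      g∉B g∈B with g Finₚ.≟ x
      ... | yes refl = <-<-≤-contradiction f<y y<g (f-max x (replaces-self basisB x∈B))
      ... | no  g≢x  = g∉B′-y (x∈p∧x≢y⇒x∈p-y (p⊆p∪⁅y⁆ (x∈p∧x≢y⇒x∈p-y g∈B g≢x))
                                             (Finₚ.<⇒≢ y<g ∘ sym))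

      no-augmentation : ∀ h → h ∈ B → h ∉ T → ¬ Indep (T ∪ ⁅ h ⁆)
      no-augmentation h h∈B h∉T indep with h Finₚ.≟ x | h Finₚ.≟ y
      ... | yes refl | _ =
        ℕₚ.<⇒≱ y<g (y-max g (g∉B ∘ x∈p-y⇒x∈p , indep-⊆ B-y∪g⊆T∪x indep))
        where
        B-y∪g⊆T∪x : (B - y) ∪ ⁅ g ⁆ ⊆ T ∪ ⁅ x ⁆
        B-y∪g⊆T∪x = subst (λ S → (B - y) ∪ ⁅ g ⁆ ⊆ (S ∪ ⁅ g ⁆) ∪ ⁅ x ⁆)
                          (p─x─y≡p─y─x B y x) ∪⁅⁆-exchange
      ... | no _ | yes refl =
        <-<-≤-contradiction f<y y<g (f-max g (g∉B ∘ x∈p-y⇒x∈p , indep-⊆ ∪⁅⁆-exchange indep))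
      ... | no h≢x | no h≢y =
        h∉T (p⊆p∪⁅y⁆ (x∈p∧x≢y⇒x∈p-y (x∈p∧x≢y⇒x∈p-y h∈B h≢x) h≢y))

    ReplacementMaximal-preserved : y ∈ B - x → ReplacementMaximal B y → ReplacementMaximal B′ y
    ReplacementMaximal-preserved {y} y∈B-x y-max g replaces@(_ , C-indep) =
      decidable-stable (g Finₚ.≤? y) λ g≰y →
        let h , h∈C , h∉B-y , indep = exchange (indep-⊆ x∈p-y⇒x∈p (proj₁ basisB)) C-indep ∣B-y∣<∣C∣
        in h∉B-y (C-below-y⊆B-y (ℕₚ.≰⇒> g≰y) h∈C (y-max h (h∉B-y , indep)))
      where
      ∣B-y∣<∣C∣ : ∣ B - y ∣ ℕ.< ∣ (B′ - y) ∪ ⁅ g ⁆ ∣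
      ∣B-y∣<∣C∣ = ℕₚ.<-≤-trans (x∈p⇒∣p-x∣<∣p∣ (x∈p-y⇒x∈p y∈B-x))
                               (∣indep∣≤∣basis∣ (proj₁ basisB) (replace-basis B′-basis replaces))

      f≢y : f ≢ y
      f≢y refl = proj₁ f-replaces y∈B-x

      C-below-y⊆B-y : y <ᶠ g → ∀ {h} → h ∈ (B′ - y) ∪ ⁅ g ⁆ → h ≤ᶠ y → h ∈ B - y
      C-below-y⊆B-y y<g h∈C h≤y with x∈p∪⁅y⁆⁻ h∈C
      ... | inj₂ refl = ⊥-elim (ℕₚ.<⇒≱ y<g h≤y)
      ... | inj₁ h∈B′-y with x∈p∪⁅y⁆⁻ (x∈p-y⇒x∈p h∈B′-y)
      ...   | inj₁ h∈B-x = x∈p∧x≢y⇒x∈p-y (x∈p-y⇒x∈p h∈B-x) (x∈p-y⇒x≢y h∈B′-y)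
      ...   | inj₂ refl  =
        ⊥-elim (no-replacement-across y∈B-x y-max (Finₚ.≤∧≢⇒< h≤y f≢y) y<g replaces)

  RelBasis-delete : Decidable Indep → RelBasis M I B → x ∈ I →
                    ∃ λ B′ → RelBasis M (I - x) B′ × B - x ⊆ B′
  RelBasis-delete {I = I} {B = B} {x = x} Indep? (basisB , I⊆B , active) x∈I =
    B′ , (B′-basis , p⊆p∪⁅y⁆ ∘ -‿monoˡ I⊆B , active′) , p⊆p∪⁅y⁆
    where
    x∈B : x ∈ B
    x∈B = I⊆B x∈I

    open ReplaceByGreatest basisB x∈B
           (proj₂ (greatest (Replaces? Indep? B x) (x , replaces-self basisB x∈B)))

    active′ : ∀ e → e ∈ B′ → e ∉ I - x → IA M B′ e
    active′ e e∈B′ e∉I-x with x∈p∪⁅y⁆⁻ e∈B′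
    ... | inj₂ refl  = ReplacementMaximal⇒IA Indep? B′-basis e∈B′ f-ReplacementMaximal
    ... | inj₁ e∈B-x = ReplacementMaximal⇒IA Indep? B′-basis e∈B′
      (ReplacementMaximal-preserved e∈B-x
        (IA⇒ReplacementMaximal basisB (active e (x∈p-y⇒x∈p e∈B-x) e∉I)))
      where
      e∉I : e ∉ I
      e∉I e∈I = e∉I-x (x∈p∧x≢y⇒x∈p-y e∈I (x∈p-y⇒x≢y e∈B-x))

  RelBasis-delete-⊆ : ∀ {B′} → RelBasis M I B → RelBasis M (I - x) B′ → x ∈ I → B - x ⊆ B′
  RelBasis-delete-⊆ {B′ = B′} relB relB′ x∈I {w} w∈B-x =
    decidable-stable (w ∈? B′) λ w∉B′ → ¬¬-decidable Indep λ Indep? →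
      let B″ , relB″ , B-x⊆B″ = RelBasis-delete Indep? relB x∈I
      in w∉B′ (subst (w ∈_) (RelBasis-unique relB″ relB′) (B-x⊆B″ w∈B-x))

module _ {n : ℕ} (M : Matroid n) where

  private variable
    A C I J : Subset n
    e : Fin n

  NBC-⊆ : NBC M I → J ⊆ I → NBC M J
  NBC-⊆ nbcI J⊆I β broken β⊆J = nbcI β broken (J⊆I ∘ β⊆J)

  NBC⇒¬EA : NBC M I → ¬ EA M I e
  NBC⇒¬EA {I} {e} nbcI (_ , γ , circuit , γ⊆I∪e , e-max) =
    nbcI (γ - e) (γ , e , circuit , e-max , refl) γ-e⊆I
    where
    γ-e⊆I : γ - e ⊆ I
    γ-e⊆I w∈γ-e with x∈p∪⁅y⁆⁻ (γ⊆I∪e (x∈p-y⇒x∈p w∈γ-e))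
    ... | inj₁ w∈I = w∈I
    ... | inj₂ w≡e = ⊥-elim (x∈p-y⇒x≢y w∈γ-e w≡e)

  IA-antitone : A ⊆ C → e ∈ A → IA M C e → IA M A e
  IA-antitone A⊆C e∈A (_ , D , cocircuit , D⊆∁C∪e , e-max) =
    x∈p⇒x∉∁p e∈A , D , cocircuit , ∪⁅⁆-monoˡ (p⊆q⇒∁p⊇∁q A⊆C) ∘ D⊆∁C∪e , e-max

  ⊆⇒≤ext/int : NBC M A → A ⊆ C → ¬ ¬ (A ≤ext/int[ M ] C)
  ⊆⇒≤ext/int {A} {C} nbcA A⊆C A≰C = ¬¬-excluded-middle {A = IntRelated M A C} λ
    { (yes related)   → A≰C (inj₂ (related , A⊆C))
    ; (no  unrelated) → A≰C (inj₁ (unrelated , key-monotone)) }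
    where
    key-monotone : ∀ z → InKey M A z → InKey M C z
    key-monotone z (inj₁ (z∈A , ¬IA)) = inj₁ (A⊆C z∈A , ¬IA ∘ IA-antitone A⊆C z∈A)
    key-monotone z (inj₂ ea)          = ⊥-elim (NBC⇒¬EA nbcA ea)

module LinearExtension {n : ℕ} {M : Matroid n} {L : List (Subset n)} (ext : IsLinExtNBC M L) where

  private
    complete : ∀ J → NBC M J → J ∈ₗ L
    complete = proj₁ (proj₂ (proj₂ ext))

    monotone : ∀ i k → lookup L i ≤ext/int[ M ] lookup L k → i ≤ᶠ k
    monotone = proj₂ (proj₂ (proj₂ ext))

  NBC-lookup : ∀ k → NBC M (lookup L k)
  NBC-lookup k = All.lookup (proj₁ ext) (∈-lookup k)

  later-⊈-earlier : ∀ {i k} → i <ᶠ k → ¬ (lookup L k ⊆ lookup L i)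
  later-⊈-earlier {i} {k} i<k L[k]⊆L[i] =
    ⊆⇒≤ext/int M (NBC-lookup k) L[k]⊆L[i] λ L[k]≤L[i] → ℕₚ.<⇒≱ i<k (monotone k i L[k]≤L[i])

  NBC-⊂-earlier : ∀ {J k} → NBC M J → J ⊂ lookup L k → ∃ λ j → j <ᶠ k × lookup L j ≡ J
  NBC-⊂-earlier {J} {k} nbcJ J⊂L[k] = j , j<k , sym J≡L[j]
    where
    J∈L : J ∈ₗ L
    J∈L = complete J nbcJ
    j : Fin (length L)
    j = index J∈L
    J≡L[j] : J ≡ lookup L j
    J≡L[j] = lookup-index J∈L
    j<k : j <ᶠ k
    j<k = decidable-stable (j Finₚ.<? k) λ j≮k →
      ⊆⇒≤ext/int M nbcJ (proj₁ J⊂L[k]) λ J≤L[k] →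
        j≮k (Finₚ.≤∧≢⇒< (monotone j k (subst (_≤ext/int[ M ] lookup L k) J≡L[j] J≤L[k]))
                        λ j≡k → ⊂-irref (trans J≡L[j] (cong (lookup L) j≡k)) J⊂L[k])

∩F-⊆F-minusV : ∀ {n} (F F′ : Face {n}) v → ¬ v ∈V F → (F ∩F F′) ⊆F (F′ minusV v)
∩F-⊆F-minusV (Y , Z) (Y′ , Z′) (inj₁ e) e∉Y =
  (λ w∈ → x∈p∧x≢y⇒x∈p-y (p∩q⊆q Y Y′ w∈) λ { refl → e∉Y (p∩q⊆p Y Y′ w∈) }) , p∩q⊆q Z Z′
∩F-⊆F-minusV (Y , Z) (Y′ , Z′) (inj₂ e) e∉Z =
  p∩q⊆q Y Y′ , λ w∈ → x∈p∧x≢y⇒x∈p-y (p∩q⊆q Z Z′ w∈) λ { refl → e∉Z (p∩q⊆p Z Z′ w∈) }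

G-delete : ∀ {n} {I B B′ : Subset n} {x} → x ∈ I → B - x ⊆ B′ →
           G (I - x) B′ ∩F G I B ≡ G I B minusV inj₂ x
G-delete {I = I} {B} {B′} {x} x∈I B-x⊆B′ =
  cong₂ _,_ (⊆-antisym (p∩q⊆q _ _) (λ w∈ → x∈p∩q⁺ (y-part w∈ , w∈)))
            (⊆-antisym (p∩q⊆p _ _) (λ w∈ → x∈p∩q⁺ (w∈ , x∈p-y⇒x∈p w∈)))
  where
  y-part : B ∩ ∁ I ⊆ B′ ∩ ∁ (I - x)
  y-part w∈ with x∈p∩q⁻ B (∁ I) w∈
  ... | w∈B , w∈∁I =
    x∈p∩q⁺ (B-x⊆B′ (x∈p∧x≢y⇒x∈p-y w∈B λ { refl → x∈∁p⇒x∉p w∈∁I x∈I })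
           , x∉p⇒x∈∁p (x∈∁p⇒x∉p w∈∁I ∘ x∈p-y⇒x∈p))

theorem7p3 : {n : ℕ} (M : Matroid n) (L : List (Subset n)) →
    IsLinExtNBC M L →
    (Bs : Fin (length L) → Subset n) →
    (∀ i → RelBasis M (lookup L i) (Bs i)) →
    IsShelling (length L) (λ i → G (lookup L i) (Bs i))
theorem7p3 M L ext Bs rel i k i<k =
  let x , x∈L[k] , x∉L[i] = ¬⊆⇒∃∉ (later-⊈-earlier i<k)
      j , j<k , L[j]≡L[k]-x =
        NBC-⊂-earlier (NBC-⊆ M (NBC-lookup k) (p─q⊆p _ _)) (x∈p⇒p-x⊂p x∈L[k])
      Bs[k]-x⊆Bs[j] = RelBasis-delete-⊆ (rel k)
        (subst (λ J → RelBasis M J (Bs j)) L[j]≡L[k]-x (rel j)) x∈L[k]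

      adjacent : F j ∩F F k ≡ F k minusV inj₂ x
      adjacent = subst (λ J → G J (Bs j) ∩F F k ≡ F k minusV inj₂ x) (sym L[j]≡L[k]-x)
                       (G-delete x∈L[k] Bs[k]-x⊆Bs[j])
  in j , j<k , inj₂ x , x∈L[k]
     , subst ((F i ∩F F k) ⊆F_) (sym adjacent) (∩F-⊆F-minusV (F i) (F k) (inj₂ x) x∉L[i])
     , adjacent
  where
  open LinearExtension {M = M} {L = L} ext
  open MatroidProperties M using (RelBasis-delete-⊆)
  F : Fin (length L) → Face
  F i = G (lookup L i) (Bs i)
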